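{- Let $\varphi(x;z)$ and $\tilde\varphi(x;z)$ be stably separated formulas and let $\mathcal{D},\tilde{\mathcal{D}}\subseteq\mathcal{U}^{|z|}$ be half-honestly finitely separated by $\varphi,\tilde\varphi$. Then for some $m<\omega$ the sets $\mathcal{D},\tilde{\mathcal{D}}$ are honestly finitely separated by $\psi,\tilde\psi$, where $\psi(x_0,\dots,x_m;z)=\varphi(x_0;z)\wedge\dots\wedge\varphi(x_m;z)$ and $\tilde\psi(x_0,\dots,x_m;z)=\tilde\varphi(x_0;z)\vee\dots\vee\tilde\varphi(x_m;z)$.
   Context: $\mathcal{U}$ is a structure for a first-order language $\mathcal{L}$ (in the paper, the monster model of the positive setting; no saturation is used), and $\varphi(x;z),\tilde\varphi(x;z)$ are arbitrary $\mathcal{L}$-formulas, $x,z$ finite tuples of variables. For a formula $\chi(x;z)$ and $a\in\mathcal{U}^{|x|}$, $\chi(a;\mathcal{U})=\{b\in\mathcal{U}^{|z|}:\mathcal{U}\models\chi(a;b)\}$. $\varphi,\tilde\varphi$ are stably separated if for some $n<\omega$ there is no sequence $\langle a_i;b_i:i<n\rangle$ with $\mathcal{U}\models\varphi(a_i;b_j)\wedge\tilde\varphi(a_j;b_i)$ for all $i<j<n$. Sets $\mathcal{D},\tilde{\mathcal{D}}\subseteq\mathcal{U}^{|z|}$ are finitely separated by $\varphi,\tilde\varphi$ if for every finite $B\subseteq\mathcal{U}^{|z|}$ there is $a\in\mathcal{U}^{|x|}$ with (ii) $B\cap\mathcal{D}\subseteq\varphi(a;\mathcal{U})$ and (iii)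 $B\cap\tilde{\mathcal{D}}\subseteq\tilde\varphi(a;\mathcal{U})$. They are half-honestly finitely separated if moreover $a$ can be chosen so that also (iv) $\mathcal{D}\cap\tilde\varphi(a;\mathcal{U})=\emptyset$; honestly finitely separated if $a$ can be chosen satisfying (ii), (iii), (iv) and (v) $\tilde{\mathcal{D}}\cap\varphi(a;\mathcal{U})=\emptyset$. These notions apply to any pair of formulas in place of $\varphi,\tilde\varphi$ (with the tuple of variables $x$ replaced accordingly). -}

module Defs where

open import Data.Nat using (ℕ; suc; _<_)
open import Data.Fin using (Fin; toℕ)
open import Data.Vec using (Vec)
open import Data.List using (List)
open import Data.List.Membership.Propositional using (_∈_)
open import Data.Product using (Σ; ∃; _×_)
open import Relation.Nullary using (¬_)
open import Data.Empty using (⊥)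

-- A structure 𝒰 with carrier M.  A formula χ(x;z) with |x| = k, |z| = l is
-- represented by its satisfaction relation  χ a b  ⟺  𝒰 ⊨ χ(a;b)
-- on M^k × M^l (tuples as vectors).
Rel : Set → ℕ → ℕ → Set₁
Rel M k l = Vec M k → Vec M l → Set

Pred : Set → ℕ → Set₁
Pred M l = Vec M l → Set

-- The separation notions are stated for an arbitrary parameter type X of the
-- x-variables (X = M^k for φ, and X = (M^k)^(m+1) for ψ), as the context says
-- they apply to any pair of formulas with x replaced accordingly.
module _ {M : Set} {X : Set} {l : ℕ} where

  StablySeparated : (X → Vec M l → Set) → (X → Vec M l → Set) → Set
  StablySeparated φ φ̃ =
    Σ ℕ λ n → ¬ (Σ (Fin n → X) λ a → Σ (Fin n → Vec M l) λ b →
      ∀ (i j : Fin n) → toℕ i < toℕ j → φ (a i) (b j) × φ̃ (a j) (b i))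

  Cond-ii : (X → Vec M l → Set) → Pred M l → List (Vec M l) → X → Set
  Cond-ii φ D B a = ∀ b → b ∈ B → D b → φ a b

  Cond-iii : (X → Vec M l → Set) → Pred M l → List (Vec M l) → X → Set
  Cond-iii φ̃ D̃ B a = ∀ b → b ∈ B → D̃ b → φ̃ a b

  Cond-iv : (X → Vec M l → Set) → Pred M l → X → Set
  Cond-iv φ̃ D a = ∀ b → D b → φ̃ a b → ⊥

  Cond-v : (X → Vec M l → Set) → Pred M l → X → Set
  Cond-v φ D̃ a = ∀ b → D̃ b → φ a b → ⊥

  FinitelySeparated : Pred M l → Pred M l → (X → Vec M l → Set) → (X → Vec M l → Set) → Set
  FinitelySeparated D D̃ φ φ̃ =
    ∀ (B : List (Vec M l)) → Σ (X) λ a → Cond-ii φ D B a × Cond-iii φ̃ D̃ B a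

  HalfHonestlyFinitelySeparated : Pred M l → Pred M l → (X → Vec M l → Set) → (X → Vec M l → Set) → Set
  HalfHonestlyFinitelySeparated D D̃ φ φ̃ =
    ∀ (B : List (Vec M l)) → Σ (X) λ a →
      Cond-ii φ D B a × Cond-iii φ̃ D̃ B a × Cond-iv φ̃ D a

  HonestlyFinitelySeparated : Pred M l → Pred M l → (X → Vec M l → Set) → (X → Vec M l → Set) → Set
  HonestlyFinitelySeparated D D̃ φ φ̃ =
    ∀ (B : List (Vec M l)) → Σ (X) λ a →
      Cond-ii φ D B a × Cond-iii φ̃ D̃ B a × Cond-iv φ̃ D a × Cond-v φ D̃ a

-- Tuples (x₀,…,xₘ) of k-tuples: x-parameter space (M^k)^(m+1) ≅ M^((m+1)k).

module _ {M : Set} {k l : ℕ} where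

  BigAnd : (m : ℕ) → Rel M k l → Vec (Vec M k) (suc m) → Vec M l → Set
  BigAnd m φ xs b = ∀ (i : Fin (suc m)) → φ (Data.Vec.lookup xs i) b

  BigOr : (m : ℕ) → Rel M k l → Vec (Vec M k) (suc m) → Vec M l → Set
  BigOr m φ̃ xs b = ∃ λ (i : Fin (suc m)) → φ̃ (Data.Vec.lookup xs i) b

-- Start with a half-honest witness a₀ for B and grow a ladder: while some b ∈ 𝒟̃
-- satisfies φ(aᵢ;b) for all i ≤ t, call it bₜ and let aₜ₊₁ be a half-honest
-- witness for B ∪ {b₀,…,bₜ}; then φ(aᵢ;bⱼ) for i ≤ j and φ̃(aᵢ;bⱼ) for j < i.
-- A ladder of height n is forbidden by stable separation with bound n, so the
-- ladder gets stuck at some t ≤ n, and then (a₀,…,aₜ, padded to n+1 entries)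
-- is an honest witness for ψ, ψ̃ with m = n: condition (v) is exactly stuckness.
module Submission where

open import Defs
open import Data.Nat using (ℕ; zero; suc; z≤n; s≤s; _≤_; _<_; _<?_)
open import Data.Nat.Properties using (≤-refl; ≤-trans; <-≤-trans; ≤-pred; ≤-<-trans; <⇒≤; ≮⇒≥)
open import Data.Vec using (Vec; tabulate; lookup)
open import Data.Vec.Properties using (lookup∘tabulate)
open import Data.Fin as Fin using (Fin; toℕ; fromℕ<)
open import Data.Fin.Properties using (toℕ-fromℕ<; toℕ<n)
open import Data.List using (List; _++_; applyUpTo)
open import Data.List.Membership.Propositional.Properties using (∈-++⁺ˡ; ∈-++⁺ʳ; ∈-applyUpTo⁺)
open import Data.Product using (Σ; ∃; _×_; _,_; proj₁; proj₂)
open import Data.Sum using (_⊎_; inj₁; inj₂; [_,_]′)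
open import Data.Empty using (⊥-elim)
open import Function using (id; _∘_)
open import Relation.Nullary using (yes; no; ¬_)
open import Relation.Binary.PropositionalEquality using (_≡_; refl; sym; trans; cong; subst)
open import Axiom.ExcludedMiddle using (ExcludedMiddle)
open import Level using (0ℓ)

switchAt : {A : Set} (t : ℕ) → ((i : ℕ) → .(i < t) → A) → A → ℕ → A
switchAt t f v i with i <? t
... | yes i<t = f i i<t
... | no _ = v

switchAt-< : {A : Set} {t : ℕ} (f : (i : ℕ) → .(i < t) → A) {v : A} {i : ℕ} (i<t : i < t) →
  switchAt t f v i ≡ f i i<t
switchAt-< {t = t} f {i = i} i<t with i <? t
... | yes _ = refl
... | no i≮t = ⊥-elim (i≮t i<t)

switchAt-elim : {A : Set} (P : ℕ → A → Set) (t : ℕ) (f : (i : ℕ) → .(i < t) → A) (v : A) →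
  (∀ {i} (i<t : i < t) → P i (f i i<t)) → (∀ {i} → t ≤ i → P i v) → ∀ i → P i (switchAt t f v i)
switchAt-elim P t f v below above i with i <? t
... | yes i<t = below i<t
... | no i≮t = above (≮⇒≥ i≮t)

module _ {M X : Set} {l : ℕ} (φ φ̃ : X → Vec M l → Set) (D D̃ : Pred M l) where

  HalfHonestWitness : List (Vec M l) → X → Set
  HalfHonestWitness B a = Cond-ii φ D B a × Cond-iii φ̃ D̃ B a × Cond-iv φ̃ D a

  HonestWitness : List (Vec M l) → X → Set
  HonestWitness B a = Cond-ii φ D B a × Cond-iii φ̃ D̃ B a × Cond-iv φ̃ D a × Cond-v φ D̃ a

  HalfHonestWitness-++ˡ : ∀ {B} B′ {a} → HalfHonestWitness (B ++ B′) a → HalfHonestWitness B a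
  HalfHonestWitness-++ˡ B′ (ii , iii , iv) =
    (λ b b∈B → ii b (∈-++⁺ˡ b∈B)) , (λ b b∈B → iii b (∈-++⁺ˡ b∈B)) , iv

  Alternating : ℕ → Set
  Alternating n = Σ (Fin n → X) λ a → Σ (Fin n → Vec M l) λ b →
    ∀ (i j : Fin n) → toℕ i < toℕ j → φ (a i) (b j) × φ̃ (a j) (b i)

  -- All aᵢ are witnesses, not only those with i ≤ t, so that the ladder can be
  -- read off as a tuple of any length.  The bⱼ exist only below t (M may be
  -- empty); the bound is irrelevant, so any proof of j < t gives the same bⱼ.
  record Ladder (B : List (Vec M l)) (t : ℕ) : Set where
    field
      a : ℕ → X
      b : (j : ℕ) → .(j < t) → Vec M l
      a-witness : ∀ i → HalfHonestWitness B (a i)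
      b-D̃ : ∀ {j} (j<t : j < t) → D̃ (b j j<t)
      φ-below : ∀ {i j} → i ≤ j → (j<t : j < t) → φ (a i) (b j j<t)
      φ̃-above : ∀ {i j} (j<i : j < i) (i≤t : i ≤ t) → φ̃ (a i) (b j (<-≤-trans j<i i≤t))

    Extendable : Set
    Extendable = ∃ λ b* → D̃ b* × (∀ i → i ≤ t → φ (a i) b*)

  ladder⇒alternating : ∀ {B n} → Ladder B n → Alternating n
  ladder⇒alternating L =
    a ∘ toℕ , (λ j → b (toℕ j) (toℕ<n j)) ,
    λ i j i<j → φ-below (<⇒≤ i<j) (toℕ<n j) , φ̃-above i<j (<⇒≤ (toℕ<n j))
    where open Ladder L

  module _ (HH : HalfHonestlyFinitelySeparated D D̃ φ φ̃) (B : List (Vec M l)) where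

    initial : Ladder B 0
    initial = record
      { a = λ _ → proj₁ (HH B) ; b = λ _ ()
      ; a-witness = λ _ → proj₂ (HH B)
      ; b-D̃ = λ () ; φ-below = λ _ () ; φ̃-above = λ { () z≤n } }

    extend : ∀ {t} (L : Ladder B t) → Ladder.Extendable L → Ladder B (suc t)
    extend {t} L (b* , D̃b* , φb*) = record
      { a = a′ ; b = λ j _ → b′ j ; a-witness = a′-witness ; b-D̃ = b′-D̃
      ; φ-below = φ-below′ ; φ̃-above = φ̃-above′ }
      where
        open Ladder L
        b′ : ℕ → Vec M l
        b′ = switchAt t b b*
        B′ : List (Vec M l)
        B′ = B ++ applyUpTo b′ (suc t)
        a* : X
        a* = proj₁ (HH B′)
        a*-witness : HalfHonestWitness B′ a*
        a*-witness = proj₂ (HH B′)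
        a-below : (i : ℕ) → .(i < suc t) → X
        a-below i _ = a i
        a′ : ℕ → X
        a′ = switchAt (suc t) a-below a*

        a′-witness : ∀ i → HalfHonestWitness B (a′ i)
        a′-witness = switchAt-elim (λ _ → HalfHonestWitness B) (suc t) a-below a*
          (λ _ → a-witness _) (λ _ → HalfHonestWitness-++ˡ (applyUpTo b′ (suc t)) a*-witness)

        b′-D̃ : ∀ {j} → j < suc t → D̃ (b′ j)
        b′-D̃ {j} = switchAt-elim (λ j x → j < suc t → D̃ x) t b b*
          (λ j<t _ → b-D̃ j<t) (λ _ _ → D̃b*) j

        φ-below′ : ∀ {i j} → i ≤ j → j < suc t → φ (a′ i) (b′ j)
        φ-below′ {i} {j} i≤j j<1+t rewrite switchAt-< a-below {a*} (≤-<-trans i≤j j<1+t) =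
          switchAt-elim (λ j x → i ≤ j → j < suc t → φ (a i) x) t b b*
            (λ j<t i≤j _ → φ-below i≤j j<t)
            (λ _ i≤j j<1+t → φb* i (≤-trans i≤j (≤-pred j<1+t)))
            j i≤j j<1+t

        -- For i = t + 1 the bⱼ were added to the list that a* half-honestly separates.
        φ̃-above′ : ∀ {i j} → j < i → i ≤ suc t → φ̃ (a′ i) (b′ j)
        φ̃-above′ {i} {j} = switchAt-elim (λ i x → j < i → i ≤ suc t → φ̃ x (b′ j)) (suc t) a-below a*
          (λ i<1+t j<i _ → let i≤t = ≤-pred i<1+t in
            subst (φ̃ (a _)) (sym (switchAt-< b (<-≤-trans j<i i≤t))) (φ̃-above j<i i≤t))
          (λ _ j<i i≤1+t → let j<1+t = <-≤-trans j<i i≤1+t in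
            proj₁ (proj₂ a*-witness) (b′ j) (∈-++⁺ʳ B (∈-applyUpTo⁺ b′ j<1+t)) (b′-D̃ j<1+t))
          i

module _ {M : Set} {k l : ℕ} (φ φ̃ : Rel M k l) (D D̃ : Pred M l) (B : List (Vec M l)) where

  conjunction-honest : ∀ {n} (xs : Vec (Vec M k) (suc n)) →
    (∀ i → HalfHonestWitness φ φ̃ D D̃ B (lookup xs i)) → Cond-v (BigAnd n φ) D̃ xs →
    HonestWitness (BigAnd n φ) (BigOr n φ̃) D D̃ B xs
  conjunction-honest xs witness v =
      (λ b b∈B Db i → proj₁ (witness i) b b∈B Db)
    , (λ b b∈B D̃b → Fin.zero , proj₁ (proj₂ (witness Fin.zero)) b b∈B D̃b)
    , (λ { b Db (i , φ̃b) → proj₂ (proj₂ (witness i)) b Db φ̃b })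
    , v

  module _ (HH : HalfHonestlyFinitelySeparated D D̃ φ φ̃) where

    stuck⇒honest : ∀ {t n} → t ≤ n → (L : Ladder φ φ̃ D D̃ B t) → ¬ Ladder.Extendable L →
      Σ (Vec (Vec M k) (suc n)) (HonestWitness (BigAnd n φ) (BigOr n φ̃) D D̃ B)
    stuck⇒honest {n = n} t≤n L stuck = xs , conjunction-honest xs xs-witness xs-v
      where
        open Ladder L
        xs : Vec (Vec M k) (suc n)
        xs = tabulate (a ∘ toℕ)
        xs-witness : ∀ i → HalfHonestWitness φ φ̃ D D̃ B (lookup xs i)
        xs-witness i = subst (HalfHonestWitness φ φ̃ D D̃ B)
          (sym (lookup∘tabulate (a ∘ toℕ) i)) (a-witness (toℕ i))
        xs-v : Cond-v (BigAnd n φ) D̃ xs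
        xs-v b D̃b φb = stuck (b , D̃b , λ i i≤t →
          let i<1+n = s≤s (≤-trans i≤t t≤n)
          in subst (λ x → φ x b)
               (trans (lookup∘tabulate (a ∘ toℕ) _) (cong a (toℕ-fromℕ< i<1+n)))
               (φb (fromℕ< i<1+n)))

    honest⊎ladder : (em : ExcludedMiddle 0ℓ) → ∀ {n} t → t ≤ n →
      Σ (Vec (Vec M k) (suc n)) (HonestWitness (BigAnd n φ) (BigOr n φ̃) D D̃ B) ⊎ Ladder φ φ̃ D D̃ B t
    honest⊎ladder em zero _ = inj₂ (initial φ φ̃ D D̃ HH B)
    honest⊎ladder em (suc t) t<n with honest⊎ladder em t (<⇒≤ t<n)
    ... | inj₁ honest = inj₁ honest
    ... | inj₂ L with em {Ladder.Extendable L}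
    ...   | yes extendable = inj₂ (extend φ φ̃ D D̃ HH B L extendable)
    ...   | no stuck = inj₁ (stuck⇒honest (<⇒≤ t<n) L stuck)

lemma11p2 : ExcludedMiddle 0ℓ →
    {M : Set} {k l : ℕ} (φ φ̃ : Rel M k l) (D D̃ : Pred M l) →
    StablySeparated φ φ̃ →
    HalfHonestlyFinitelySeparated D D̃ φ φ̃ →
    Σ ℕ λ m → HonestlyFinitelySeparated D D̃ (BigAnd m φ) (BigOr m φ̃)
lemma11p2 em φ φ̃ D D̃ (n , no-alternating) HH = n , λ B →
  [ id , ⊥-elim ∘ no-alternating ∘ ladder⇒alternating φ φ̃ D D̃ ]′
    (honest⊎ladder φ φ̃ D D̃ B HH em n ≤-refl)
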